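{- There is an $O(\sqrt{d})$-approximation algorithm for the mutual-visibility problem on hypercubes: there exist a constant $C>0$ and an algorithm which, given $d\ge 1$, outputs a mutual-visibility set $X$ of $Q_d$ with $\mu(Q_d)/|X| \le C\sqrt{d}$.
   Context: For a connected graph $G$ and $X\subseteq V(G)$, two vertices $x,y\in V(G)$ are $X$-visible if there is a shortest $x,y$-path none of whose internal vertices lies in $X$. $X$ is a mutual-visibility set if every two vertices of $X$ are $X$-visible; $\mu(G)$ is the maximum cardinality of a mutual-visibility set of $G$. The hypercube $Q_d$ has vertex set $\{0,1\}^d$, two binary strings being adjacent if and only if they differ in exactly one position. -}

module Defs where

open import Data.Nat using (ℕ; zero; suc; _+_; _≤_)
open import Data.Bool using (Bool; true; false; _xor_)
open import Data.Vec using (Vec; []; _∷_)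
open import Data.List using (List; []; _∷_)
open import Data.List.Membership.Propositional using (_∈_; _∉_)
open import Data.List.Relation.Unary.All using (All)
open import Data.Product using (Σ; ∃; _×_)
open import Relation.Binary.PropositionalEquality using (_≡_)

Vertex : ℕ → Set
Vertex d = Vec Bool d

hamming : ∀ {d} → Vertex d → Vertex d → ℕ
hamming [] [] = 0
hamming (a ∷ u) (b ∷ v) with a xor b
... | true  = suc (hamming u v)
... | false = hamming u v

Adj : ∀ {d} → Vertex d → Vertex d → Set
Adj u v = hamming u v ≡ 1

data Walk {d : ℕ} : Vertex d → Vertex d → ℕ → Set where
  nil  : ∀ {x} → Walk x x 0
  step : ∀ {x y z n} → Adj x y → Walk y z n → Walk x z (suc n)

inner : ∀ {d} {x y : Vertex d} {n} → Walk x y n → List (Vertex d)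
inner nil = []
inner (step _ nil) = []
inner (step {y = y} _ (step {y = y′} b w)) = y ∷ inner (step {x = y} {y = y′} b w)

-- A shortest x,y-walk: no x,y-walk has fewer edges (shortest walks are paths).
Shortest : ∀ {d} {x y : Vertex d} {n} → Walk x y n → Set
Shortest {d} {x} {y} {n} _ = ∀ m → Walk x y m → n ≤ m

Visible : ∀ {d} → List (Vertex d) → Vertex d → Vertex d → Set
Visible X x y = ∃ λ n → Σ (Walk x y n) λ w → Shortest w × All (_∉ X) (inner w)

IsMutualVisibility : ∀ {d} → List (Vertex d) → Set
IsMutualVisibility X = ∀ {x y} → x ∈ X → y ∈ X → Visible X x y

-- The algorithm outputs the middle level {x : weight x = ⌊d/2⌋} of Q_d.  Two vertices x, y of the
-- same weight k are joined by a shortest path that first switches off the ones of x missing in y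
-- and then switches on the ones of y missing in x; all its internal vertices have weight < k, so
-- any set of vertices of equal weight is a mutual-visibility set.  For the ratio it suffices to
-- compare with the trivial bound μ(Q_d) ≤ 2^d: from (n+1)·C(2n+2,n+1) = 2(2n+1)·C(2n,n) one gets
-- 16^n ≤ 4n·C(2n,n)² by induction, hence 4^d ≤ 16d·C(d,⌊d/2⌋)², i.e. 2^d ≤ 4√d·C(d,⌊d/2⌋).
module Submission where

open import Defs
open import Data.Nat using (ℕ; _*_; _^_; _≤_; _<_)
open import Data.List using (List; length)
open import Data.List.Relation.Unary.Unique.Propositional using (Unique)
open import Data.Product using (Σ; ∃; _×_)

open import Data.Nat using (zero; suc; _+_; z≤n; s≤s; s<s; ⌊_/2⌋)
open import Data.Nat.Properties
open import Data.Nat.Combinatorics using (_C_; nCk+nC[k+1]≡[n+1]C[k+1]; nCk≡nC[n∸k]; nC1≡n)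
open import Data.Nat.Tactic.RingSolver using (solve-∀)
open import Data.Bool using (Bool; true; false; _∧_)
import Data.Bool.Properties as Bool
open import Data.Vec using ([]; _∷_)
open import Data.List using ([]; _∷_; map; _++_)
open import Data.List.Properties using (length-map; length-++)
open import Data.List.Membership.Propositional using (_∈_; _∉_)
open import Data.List.Membership.Propositional.Properties using (∈-map⁻)
open import Data.List.Relation.Unary.Any using (here; there)
open import Data.List.Relation.Unary.All as All using (All; []; _∷_)
import Data.List.Relation.Unary.All.Properties as All
open import Data.List.Relation.Unary.AllPairs using ([]; _∷_)
import Data.List.Relation.Unary.Unique.Propositional.Properties as Unique
open import Data.Product using (_,_)
open import Data.Empty using (⊥)
open import Relation.Nullary using (yes; no; contradiction)
open import Relation.Binary.PropositionalEquality

private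
  variable
    d n m : ℕ
    x y z : Vertex d

weight : Vertex d → ℕ
weight [] = 0
weight (true ∷ v) = suc (weight v)
weight (false ∷ v) = weight v

∷-injectiveʳ : ∀ {b} {u v : Vertex d} → _≡_ {A = Vertex (suc d)} (b ∷ u) (b ∷ v) → u ≡ v
∷-injectiveʳ refl = refl

level : (d k : ℕ) → List (Vertex d)
level zero zero = [] ∷ []
level zero (suc k) = []
level (suc d) zero = map (false ∷_) (level d zero)
level (suc d) (suc k) = map (true ∷_) (level d k) ++ map (false ∷_) (level d (suc k))

level-weight : ∀ d k → All (λ x → weight x ≡ k) (level d k)
level-weight zero zero = refl ∷ []
level-weight zero (suc k) = []
level-weight (suc d) zero = All.map⁺ (level-weight d zero)
level-weight (suc d) (suc k) =
  All.++⁺ (All.map⁺ (All.map (cong suc) (level-weight d k))) (All.map⁺ (level-weight d (suc k)))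

level-unique : ∀ d k → Unique (level d k)
level-unique zero zero = [] ∷ []
level-unique zero (suc k) = []
level-unique (suc d) zero = Unique.map⁺ ∷-injectiveʳ (level-unique d zero)
level-unique (suc d) (suc k) =
  Unique.++⁺ (Unique.map⁺ ∷-injectiveʳ (level-unique d k))
             (Unique.map⁺ ∷-injectiveʳ (level-unique d (suc k))) disjoint
  where
  disjoint : ∀ {v} → v ∈ map (true ∷_) (level d k) × v ∈ map (false ∷_) (level d (suc k)) → ⊥
  disjoint (p , q) with ∈-map⁻ _ p | ∈-map⁻ _ q
  ... | _ , _ , refl | _ , _ , ()

length-level : ∀ d k → length (level d k) ≡ d C k
length-level zero zero = refl
length-level zero (suc k) = refl
length-level (suc d) zero = trans (length-map _ (level d zero)) (length-level d zero)
length-level (suc d) (suc k) = begin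
  length (map (true ∷_) (level d k) ++ map (false ∷_) (level d (suc k)))
    ≡⟨ length-++ (map (true ∷_) (level d k)) ⟩
  length (map (true ∷_) (level d k)) + length (map (false ∷_) (level d (suc k)))
    ≡⟨ cong₂ _+_ (length-map _ (level d k)) (length-map _ (level d (suc k))) ⟩
  length (level d k) + length (level d (suc k))
    ≡⟨ cong₂ _+_ (length-level d k) (length-level d (suc k)) ⟩
  d C k + d C suc k
    ≡⟨ nCk+nC[k+1]≡[n+1]C[k+1] d k ⟩
  suc d C suc k ∎
  where open ≡-Reasoning

lift : ∀ b → Walk x y n → Walk (b ∷ x) (b ∷ y) n
lift b nil = nil
lift true (step a w) = step a (lift true w)
lift false (step a w) = step a (lift false w)

append : Walk x y n → Walk y z m → Walk x z (n + m)
append nil w = w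
append (step a w₁) w₂ = step a (append w₁ w₂)

snoc : Walk x y n → Adj y z → Walk x z (suc n)
snoc nil a = step a nil
snoc (step b w) a = step b (snoc w a)

tailVertices : {x y : Vertex d} → Walk x y n → List (Vertex d)
tailVertices nil = []
tailVertices (step {y = y} _ w) = y ∷ tailVertices w

initVertices : {x y : Vertex d} → Walk x y n → List (Vertex d)
initVertices nil = []
initVertices (step {x = x} _ w) = x ∷ initVertices w

module _ {p} {P : Vertex (suc d) → Set p} where

  All-tailVertices-lift : ∀ b (w : Walk x y n) →
    All (λ v → P (b ∷ v)) (tailVertices w) → All P (tailVertices (lift b w))
  All-tailVertices-lift b nil [] = []
  All-tailVertices-lift true (step a w) (p ∷ ps) = p ∷ All-tailVertices-lift true w ps
  All-tailVertices-lift false (step a w) (p ∷ ps) = p ∷ All-tailVertices-lift false w ps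

  All-initVertices-lift : ∀ b (w : Walk x y n) →
    All (λ v → P (b ∷ v)) (initVertices w) → All P (initVertices (lift b w))
  All-initVertices-lift b nil [] = []
  All-initVertices-lift true (step a w) (p ∷ ps) = p ∷ All-initVertices-lift true w ps
  All-initVertices-lift false (step a w) (p ∷ ps) = p ∷ All-initVertices-lift false w ps

module _ {p} {P : Vertex d → Set p} where

  All-initVertices-snoc : (w : Walk x y n) (a : Adj y z) →
    All P (initVertices w) → P y → All P (initVertices (snoc w a))
  All-initVertices-snoc nil a [] py = py ∷ []
  All-initVertices-snoc (step b w) a (p ∷ ps) py = p ∷ All-initVertices-snoc w a ps py

  All-inner : (w : Walk x y n) → All P (initVertices w) → All P (inner w)
  All-inner nil _ = []
  All-inner (step a nil) _ = []
  All-inner (step a (step b w)) (_ ∷ ps@(py ∷ _)) = py ∷ All-inner (step b w) ps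

  All-inner-append : (w₁ : Walk x y n) (w₂ : Walk y z m) →
    All P (tailVertices w₁) → All P (initVertices w₂) → All P (inner (append w₁ w₂))
  All-inner-append nil w₂ _ qs = All-inner w₂ qs
  All-inner-append (step a nil) nil _ _ = []
  All-inner-append (step a nil) (step b w) _ qs@(q ∷ _) = q ∷ All-inner (step b w) qs
  All-inner-append (step a (step b w₁)) w₂ (p ∷ ps) qs = p ∷ All-inner-append (step b w₁) w₂ ps qs

hamming-refl : (x : Vertex d) → hamming x x ≡ 0
hamming-refl [] = refl
hamming-refl (true ∷ x) = hamming-refl x
hamming-refl (false ∷ x) = hamming-refl x

private
  m≤n+o⇒1+m≤n+1+o : ∀ {a b c} → a ≤ b + c → suc a ≤ b + suc c
  m≤n+o⇒1+m≤n+1+o {b = b} {c} p = ≤-trans (s≤s p) (≤-reflexive (sym (+-suc b c)))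

  m≤n+o⇒m≤1+n+1+o : ∀ {a b c} → a ≤ b + c → a ≤ suc b + suc c
  m≤n+o⇒m≤1+n+1+o {b = b} {c} p = m≤n⇒m≤1+n (≤-trans (m≤n⇒m≤1+n p) (≤-reflexive (sym (+-suc b c))))

hamming-triangle : (x y z : Vertex d) → hamming x z ≤ hamming x y + hamming y z
hamming-triangle [] [] [] = z≤n
hamming-triangle (true ∷ u) (true ∷ v) (true ∷ w) = hamming-triangle u v w
hamming-triangle (true ∷ u) (true ∷ v) (false ∷ w) = m≤n+o⇒1+m≤n+1+o (hamming-triangle u v w)
hamming-triangle (true ∷ u) (false ∷ v) (true ∷ w) = m≤n+o⇒m≤1+n+1+o (hamming-triangle u v w)
hamming-triangle (true ∷ u) (false ∷ v) (false ∷ w) = s≤s (hamming-triangle u v w)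
hamming-triangle (false ∷ u) (true ∷ v) (true ∷ w) = s≤s (hamming-triangle u v w)
hamming-triangle (false ∷ u) (true ∷ v) (false ∷ w) = m≤n+o⇒m≤1+n+1+o (hamming-triangle u v w)
hamming-triangle (false ∷ u) (false ∷ v) (true ∷ w) = m≤n+o⇒1+m≤n+1+o (hamming-triangle u v w)
hamming-triangle (false ∷ u) (false ∷ v) (false ∷ w) = hamming-triangle u v w

hamming≤length : Walk x y n → hamming x y ≤ n
hamming≤length {x = x} nil = ≤-reflexive (hamming-refl x)
hamming≤length {x = x} {n = suc n} (step {y = y} {z = z} x~y w) = begin
  hamming x z               ≤⟨ hamming-triangle x y z ⟩
  hamming x y + hamming y z ≡⟨ cong (_+ hamming y z) x~y ⟩
  suc (hamming y z)         ≤⟨ s≤s (hamming≤length w) ⟩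
  suc n                     ∎
  where open ≤-Reasoning

meet : Vertex d → Vertex d → Vertex d
meet [] [] = []
meet (a ∷ u) (b ∷ v) = (a ∧ b) ∷ meet u v

removed added : Vertex d → Vertex d → ℕ
removed [] [] = 0
removed (true ∷ u) (false ∷ v) = suc (removed u v)
removed (true ∷ u) (true ∷ v) = removed u v
removed (false ∷ u) (_ ∷ v) = removed u v
added [] [] = 0
added (false ∷ u) (true ∷ v) = suc (added u v)
added (true ∷ u) (_ ∷ v) = added u v
added (false ∷ u) (false ∷ v) = added u v

removed+added≡hamming : (x y : Vertex d) → removed x y + added x y ≡ hamming x y
removed+added≡hamming [] [] = refl
removed+added≡hamming (true ∷ u) (false ∷ v) = cong suc (removed+added≡hamming u v)
removed+added≡hamming (true ∷ u) (true ∷ v) = removed+added≡hamming u v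
removed+added≡hamming (false ∷ u) (true ∷ v) =
  trans (+-suc (removed u v) (added u v)) (cong suc (removed+added≡hamming u v))
removed+added≡hamming (false ∷ u) (false ∷ v) = removed+added≡hamming u v

switch-off : (u : Vertex d) → Adj (true ∷ u) (false ∷ u)
switch-off u = cong suc (hamming-refl u)

switch-on : (u : Vertex d) → Adj (false ∷ u) (true ∷ u)
switch-on u = cong suc (hamming-refl u)

descent : (x y : Vertex d) → Walk x (meet x y) (removed x y)
descent [] [] = nil
descent (true ∷ u) (false ∷ v) = step (switch-off u) (lift false (descent u v))
descent (true ∷ u) (true ∷ v) = lift true (descent u v)
descent (false ∷ u) (_ ∷ v) = lift false (descent u v)

ascent : (x y : Vertex d) → Walk (meet x y) y (added x y)
ascent [] [] = nil
ascent (false ∷ u) (true ∷ v) = snoc (lift false (ascent u v)) (switch-on v)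
ascent (true ∷ u) (true ∷ v) = lift true (ascent u v)
ascent (true ∷ u) (false ∷ v) = lift false (ascent u v)
ascent (false ∷ u) (false ∷ v) = lift false (ascent u v)

descent-weight : (x y : Vertex d) → All (λ v → weight v < weight x) (tailVertices (descent x y))
descent-weight [] [] = []
descent-weight (true ∷ u) (false ∷ v) =
  n<1+n _ ∷ All-tailVertices-lift false (descent u v) (All.map m<n⇒m<1+n (descent-weight u v))
descent-weight (true ∷ u) (true ∷ v) =
  All-tailVertices-lift true (descent u v) (All.map s<s (descent-weight u v))
descent-weight (false ∷ u) (_ ∷ v) = All-tailVertices-lift false (descent u v) (descent-weight u v)

ascent-weight : (x y : Vertex d) → All (λ v → weight v < weight y) (initVertices (ascent x y))
ascent-weight [] [] = []
ascent-weight (false ∷ u) (true ∷ v) =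
  All-initVertices-snoc (lift false (ascent u v)) _
    (All-initVertices-lift false (ascent u v) (All.map m<n⇒m<1+n (ascent-weight u v)))
    (n<1+n _)
ascent-weight (true ∷ u) (true ∷ v) =
  All-initVertices-lift true (ascent u v) (All.map s<s (ascent-weight u v))
ascent-weight (true ∷ u) (false ∷ v) = All-initVertices-lift false (ascent u v) (ascent-weight u v)
ascent-weight (false ∷ u) (false ∷ v) = All-initVertices-lift false (ascent u v) (ascent-weight u v)

equalWeight⇒isMutualVisibility : ∀ k {X : List (Vertex d)} →
  All (λ x → weight x ≡ k) X → IsMutualVisibility X
equalWeight⇒isMutualVisibility k {X} X-weight {x} {y} x∈X y∈X =
  removed x y + added x y , append (descent x y) (ascent x y) , shortest ,
  All-inner-append (descent x y) (ascent x y)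
    (All.map (lighter⇒∉ x∈X) (descent-weight x y)) (All.map (lighter⇒∉ y∈X) (ascent-weight x y))
  where
  shortest : ∀ n → Walk x y n → removed x y + added x y ≤ n
  shortest _ w = ≤-trans (≤-reflexive (removed+added≡hamming x y)) (hamming≤length w)

  lighter⇒∉ : ∀ {u v} → u ∈ X → weight v < weight u → v ∉ X
  lighter⇒∉ u∈X v<u v∈X =
    <-irrefl (trans (All.lookup X-weight v∈X) (sym (All.lookup X-weight u∈X))) v<u

tailsWithHead : Bool → List (Vertex (suc d)) → List (Vertex d)
tailsWithHead b [] = []
tailsWithHead b ((c ∷ v) ∷ Y) with b Bool.≟ c
... | yes _ = v ∷ tailsWithHead b Y
... | no _ = tailsWithHead b Y

∈-tailsWithHead : ∀ b (Y : List (Vertex (suc d))) {v} → v ∈ tailsWithHead b Y → (b ∷ v) ∈ Y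
∈-tailsWithHead b ((c ∷ _) ∷ Y) p with b Bool.≟ c | p
... | yes refl | here refl = here refl
... | yes refl | there q = there (∈-tailsWithHead b Y q)
... | no _ | q = there (∈-tailsWithHead b Y q)

tailsWithHead-unique : ∀ b {Y : List (Vertex (suc d))} → Unique Y → Unique (tailsWithHead b Y)
tailsWithHead-unique b {[]} _ = []
tailsWithHead-unique b {(c ∷ v) ∷ Y} (v∉Y ∷ uY) with b Bool.≟ c
... | yes refl =
  All.tabulate (λ w∈ v≡w → All.lookup v∉Y (∈-tailsWithHead b Y w∈) (cong (b ∷_) v≡w))
  ∷ tailsWithHead-unique b uY
... | no _ = tailsWithHead-unique b uY

length-tailsWithHead : (Y : List (Vertex (suc d))) →
  length Y ≡ length (tailsWithHead true Y) + length (tailsWithHead false Y)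
length-tailsWithHead [] = refl
length-tailsWithHead ((true ∷ v) ∷ Y) = cong suc (length-tailsWithHead Y)
length-tailsWithHead ((false ∷ v) ∷ Y) =
  trans (cong suc (length-tailsWithHead Y))
        (sym (+-suc (length (tailsWithHead true Y)) (length (tailsWithHead false Y))))

unique⇒length≤2^d : ∀ d {Y : List (Vertex d)} → Unique Y → length Y ≤ 2 ^ d
unique⇒length≤2^d zero {[]} _ = z≤n
unique⇒length≤2^d zero {[] ∷ []} _ = ≤-refl
unique⇒length≤2^d zero {[] ∷ [] ∷ _} ((≢[] ∷ _) ∷ _) = contradiction refl ≢[]
unique⇒length≤2^d (suc d) {Y} uY = begin
  length Y
    ≡⟨ length-tailsWithHead Y ⟩
  length (tailsWithHead true Y) + length (tailsWithHead false Y)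
    ≤⟨ +-mono-≤ (unique⇒length≤2^d d (tailsWithHead-unique true uY))
                (unique⇒length≤2^d d (tailsWithHead-unique false uY)) ⟩
  2 ^ d + 2 ^ d
    ≡⟨ cong (2 ^ d +_) (sym (+-identityʳ (2 ^ d))) ⟩
  2 ^ suc d ∎
  where open ≤-Reasoning

C-absorption : ∀ n k → suc k * (suc n C suc k) ≡ suc n * (n C k)
C-absorption n zero = trans (+-identityʳ (suc n C 1)) (trans (nC1≡n (suc n)) (sym (*-identityʳ (suc n))))
C-absorption zero (suc k) = *-zeroʳ (suc (suc k))
C-absorption (suc n) (suc k) = begin
  suc (suc k) * (suc (suc n) C suc (suc k))
    ≡⟨ cong (suc (suc k) *_) (sym (nCk+nC[k+1]≡[n+1]C[k+1] (suc n) (suc k))) ⟩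
  suc (suc k) * (suc n C suc k + suc n C suc (suc k))
    ≡⟨ split k (suc n C suc k) (suc n C suc (suc k)) ⟩
  suc n C suc k + suc k * (suc n C suc k) + suc (suc k) * (suc n C suc (suc k))
    ≡⟨ cong₂ (λ s t → suc n C suc k + s + t) (C-absorption n k) (C-absorption n (suc k)) ⟩
  suc n C suc k + suc n * (n C k) + suc n * (n C suc k)
    ≡⟨ merge n (suc n C suc k) (n C k) (n C suc k) ⟩
  suc n C suc k + suc n * (n C k + n C suc k)
    ≡⟨ cong (λ t → suc n C suc k + suc n * t) (nCk+nC[k+1]≡[n+1]C[k+1] n k) ⟩
  suc n C suc k + suc n * (suc n C suc k)
    ≡⟨⟩
  suc (suc n) * (suc n C suc k) ∎
  where
  open ≡-Reasoning
  split : ∀ k a b → suc (suc k) * (a + b) ≡ a + suc k * a + suc (suc k) * b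
  split = solve-∀
  merge : ∀ n a b c → a + suc n * b + suc n * c ≡ a + suc n * (b + c)
  merge = solve-∀

central : ℕ → ℕ
central n = (n + n) C n

central-ratio : ∀ n → suc n * central (suc n) ≡ 2 * suc (n + n) * central n
central-ratio n = begin
  suc n * ((suc n + suc n) C suc n)
    ≡⟨ cong (λ t → suc n * (suc t C suc n)) (+-suc n n) ⟩
  suc n * (suc N C suc n)
    ≡⟨ cong (suc n *_) (sym (nCk+nC[k+1]≡[n+1]C[k+1] N n)) ⟩
  suc n * (N C n + N C suc n)
    ≡⟨ cong (λ t → suc n * (t + N C suc n)) symmetric ⟩
  suc n * (N C suc n + N C suc n)
    ≡⟨ double (suc n) (N C suc n) ⟩
  2 * (suc n * (N C suc n))
    ≡⟨ cong (2 *_) (C-absorption (n + n) n) ⟩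
  2 * (N * central n)
    ≡⟨ sym (*-assoc 2 N (central n)) ⟩
  2 * N * central n ∎
  where
  open ≡-Reasoning
  N = suc (n + n)
  symmetric : N C n ≡ N C suc n
  symmetric = trans (nCk≡nC[n∸k] (m≤n⇒m≤1+n (m≤m+n n n))) (cong (N C_) (m+n∸n≡m (suc n) n))
  double : ∀ a b → a * (b + b) ≡ 2 * (a * b)
  double = solve-∀

-- After multiplying both sides by m(m+1), this is 4m(m+1) ≤ (2m+1)².
square-growth : ∀ m h a b → h ≤ 4 * m * (a * a) → suc m * b ≡ 2 * suc (m + m) * a →
  16 * h ≤ 4 * suc m * (b * b)
square-growth zero h a b h≤0 _ rewrite n≤0⇒n≡0 h≤0 = z≤n
square-growth m@(suc _) h a b h≤ ratio = *-cancelʳ-≤ (16 * h) (4 * suc m * (b * b)) (m * suc m) (begin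
  16 * h * (m * suc m)
    ≤⟨ *-monoˡ-≤ (m * suc m) (*-monoʳ-≤ 16 h≤) ⟩
  16 * (4 * m * (a * a)) * (m * suc m)
    ≡⟨ regroup m a ⟩
  16 * m * (a * a) * (4 * m * suc m)
    ≤⟨ *-monoʳ-≤ (16 * m * (a * a)) (≤-trans (n≤1+n _) (≤-reflexive (odd-square m))) ⟩
  16 * m * (a * a) * (suc (m + m) * suc (m + m))
    ≡⟨ square-out m a ⟩
  4 * m * ((2 * suc (m + m) * a) * (2 * suc (m + m) * a))
    ≡⟨ cong (λ t → 4 * m * (t * t)) (sym ratio) ⟩
  4 * m * ((suc m * b) * (suc m * b))
    ≡⟨ square-in m b ⟩
  4 * suc m * (b * b) * (m * suc m) ∎)
  where
  open ≤-Reasoning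
  regroup : ∀ m a → 16 * (4 * m * (a * a)) * (m * suc m) ≡ 16 * m * (a * a) * (4 * m * suc m)
  regroup = solve-∀
  odd-square : ∀ m → suc (4 * m * suc m) ≡ suc (m + m) * suc (m + m)
  odd-square = solve-∀
  square-out : ∀ m a → 16 * m * (a * a) * (suc (m + m) * suc (m + m))
                     ≡ 4 * m * ((2 * suc (m + m) * a) * (2 * suc (m + m) * a))
  square-out = solve-∀
  square-in : ∀ m b → 4 * m * ((suc m * b) * (suc m * b)) ≡ 4 * suc m * (b * b) * (m * suc m)
  square-in = solve-∀

16^n≤4n·central² : ∀ n → 16 ^ suc n ≤ 4 * suc n * (central (suc n) * central (suc n))
16^n≤4n·central² zero = ≤-refl
16^n≤4n·central² (suc n) =
  square-growth (suc n) (16 ^ suc n) (central (suc n)) (central (suc (suc n)))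
    (16^n≤4n·central² n) (central-ratio (suc n))

data Halving : ℕ → Set where
  even : ∀ n → Halving (n + n)
  odd  : ∀ n → Halving (suc (n + n))

halving : ∀ d → Halving d
halving zero = even zero
halving (suc d) with halving d
... | even n = odd n
... | odd n = subst Halving (cong suc (+-suc n n)) (even (suc n))

⌊2n+1/2⌋≡n : ∀ n → ⌊ suc (n + n) /2⌋ ≡ n
⌊2n+1/2⌋≡n zero = refl
⌊2n+1/2⌋≡n (suc n) rewrite +-suc n n = cong suc (⌊2n+1/2⌋≡n n)

4^[n+n]≡16^n : ∀ n → 4 ^ (n + n) ≡ 16 ^ n
4^[n+n]≡16^n n = trans (cong (λ t → 4 ^ (n + t)) (sym (+-identityʳ n))) (sym (^-*-assoc 4 2 n))

[2^d]²≡4^d : ∀ d → (2 ^ d) ^ 2 ≡ 4 ^ d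
[2^d]²≡4^d d = trans (^-*-assoc 2 d 2) (trans (cong (2 ^_) (*-comm d 2)) (sym (^-*-assoc 2 2 d)))

middle-bound-even : ∀ m → 1 ≤ m → 4 ^ (m + m) ≤ 16 * (m + m) * (((m + m) C m) * ((m + m) C m))
middle-bound-even m@(suc n) _ = begin
  4 ^ (m + m)                            ≡⟨ 4^[n+n]≡16^n m ⟩
  16 ^ m                                 ≤⟨ 16^n≤4n·central² n ⟩
  4 * m * (central m * central m)        ≤⟨ *-monoˡ-≤ (central m * central m) (*-monoˡ-≤ m (m≤m+n 4 28)) ⟩
  32 * m * (central m * central m)       ≡⟨ cong (_* (central m * central m)) (thirty-two m) ⟩
  16 * (m + m) * (central m * central m) ∎
  where
  open ≤-Reasoning
  thirty-two : ∀ m → 32 * m ≡ 16 * (m + m)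
  thirty-two = solve-∀

middle-bound-odd : ∀ m → 4 ^ suc (m + m) ≤ 16 * suc (m + m) * ((suc (m + m) C m) * (suc (m + m) C m))
middle-bound-odd zero = m≤m+n 4 12
middle-bound-odd m@(suc n) = begin
  4 ^ suc (m + m)                       ≡⟨ cong (4 *_) (4^[n+n]≡16^n m) ⟩
  4 * 16 ^ m                            ≤⟨ *-monoʳ-≤ 4 (16^n≤4n·central² n) ⟩
  4 * (4 * m * (central m * central m)) ≡⟨ sixteen m (central m) ⟩
  16 * m * (central m * central m)      ≤⟨ *-mono-≤ (*-monoʳ-≤ 16 (m≤n⇒m≤1+n (m≤m+n m m)))
                                                    (*-mono-≤ central≤ central≤) ⟩
  16 * suc (m + m) * ((suc (m + m) C m) * (suc (m + m) C m)) ∎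
  where
  open ≤-Reasoning
  sixteen : ∀ m a → 4 * (4 * m * (a * a)) ≡ 16 * m * (a * a)
  sixteen = solve-∀
  central≤ : central m ≤ suc (m + m) C m
  central≤ = ≤-trans (m≤n+m (central m) ((m + m) C n)) (≤-reflexive (nCk+nC[k+1]≡[n+1]C[k+1] (m + m) n))

m+m≥1⇒m≥1 : 1 ≤ m + m → 1 ≤ m
m+m≥1⇒m≥1 {suc m} _ = s≤s z≤n

4^d≤16d·middle² : ∀ d → 1 ≤ d → 4 ^ d ≤ 16 * d * ((d C ⌊ d /2⌋) * (d C ⌊ d /2⌋))
4^d≤16d·middle² d 1≤d with halving d
... | even m =
  subst (λ k → 4 ^ (m + m) ≤ 16 * (m + m) * (((m + m) C k) * ((m + m) C k)))
        (n≡⌊n+n/2⌋ m) (middle-bound-even m (m+m≥1⇒m≥1 1≤d))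
... | odd m =
  subst (λ k → 4 ^ suc (m + m) ≤ 16 * suc (m + m) * ((suc (m + m) C k) * (suc (m + m) C k)))
        (sym (⌊2n+1/2⌋≡n m)) (middle-bound-odd m)

middleLevel : ∀ d → List (Vertex d)
middleLevel d = level d ⌊ d /2⌋

unique⇒length²≤16d·middleLevel² : ∀ d → 1 ≤ d → {Y : List (Vertex d)} → Unique Y →
  length Y ^ 2 ≤ 4 ^ 2 * d * length (middleLevel d) ^ 2
unique⇒length²≤16d·middleLevel² d 1≤d {Y} uY = begin
  length Y ^ 2          ≤⟨ ^-monoˡ-≤ 2 (unique⇒length≤2^d d uY) ⟩
  (2 ^ d) ^ 2           ≡⟨ [2^d]²≡4^d d ⟩
  4 ^ d                 ≤⟨ 4^d≤16d·middle² d 1≤d ⟩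
  16 * d * (M * M)      ≡⟨ cong (λ t → 16 * d * (t * t)) (sym (length-level d ⌊ d /2⌋)) ⟩
  16 * d * (L * L)      ≡⟨ cong (λ t → 16 * d * (L * t)) (sym (*-identityʳ L)) ⟩
  4 ^ 2 * d * L ^ 2     ∎
  where
  open ≤-Reasoning
  M = d C ⌊ d /2⌋
  L = length (middleLevel d)

corollary4 : ∃ λ (C : ℕ) → 0 < C × Σ ((d : ℕ) → List (Vertex d)) λ alg →
    ∀ d → 1 ≤ d →
      Unique (alg d) × IsMutualVisibility (alg d) ×
      (∀ (Y : List (Vertex d)) → Unique Y → IsMutualVisibility Y →
        length Y ^ 2 ≤ C ^ 2 * d * length (alg d) ^ 2)
corollary4 = 4 , s≤s z≤n , middleLevel , λ d 1≤d →
  level-unique d ⌊ d /2⌋ ,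
  equalWeight⇒isMutualVisibility ⌊ d /2⌋ (level-weight d ⌊ d /2⌋) ,
  λ _ uY _ → unique⇒length²≤16d·middleLevel² d 1≤d uY
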